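{- Let $p$ be a prime, $m$ a positive integer divisible by $3$, $n=\frac m3(p-1)$, $0\le i\le n$. For $0\le j\le i$ let $J_j$ be an ideal of $[0,j]^2$, and assume $J_0,\dots,J_{i-1}$ is a consistent sequence. Let $J_{i,j}$ ($0\le j<i$) be as in the context, and write $\omega_{[0,i]^2}(J_i)=\bigl((x_0,y_0),\dots,(x_k,y_k)\bigr)$. Then $J_i$ is consistent with $J_0,\dots,J_{i-1}$ if and only if all of the following hold: (1) $(x_0,y_0)=(y_k,x_k)$ if $y_0=i$; (2) $\bigl(J_i\times\{i\}+\Delta\bigr)\cap\bigl([0,i-1]^2\times\{j\}\bigr)\subseteq J_{i,j}\times\{j\}$ for all $0\le j<i$; (3) $\bigl(J_{i,j}\times\{j\}+\Delta\bigr)\cap V_i\subseteq J_i\times\{i\}$ for all $0\le j<i$; (4) $\bigl(J_i\times\{i\}+\Delta\bigr)\cap V_i^A\subseteq\bigl(J_i\times\{i\}\bigr)^A$; (5) $\bigl(J_i\times\{i\}+\Delta\bigr)\cap V_i^{A^2}\subseteq\bigl(J_i\times\{i\}\bigr)^{A^2}$.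
   Context: $D=\{(x,y)\in\mathbb{R}^2: x+py\le0,\ p^2x+y\le0\}$, $\Delta=\{(x,y,z)\in\mathbb{R}^3: x+py+p^2z\le0,\ p^2x+y+pz\le0,\ px+p^2y+z\le0\}$; $u\prec v$ means $u\in v+D$ in $\mathbb{R}^2$ and $u\in v+\Delta$ in $\mathbb{R}^3$. An ideal of $\Omega$ is $I\subseteq\Omega$ with $u\in I$, $v\in\Omega$, $v\prec u\Rightarrow v\in I$. $[a,b]=\{x\in\mathbb{Z}:a\le x\le b\}$. $(x,y,z)A=(y,z,x)$, $(x,y,z)A^2=(z,x,y)$, $X^A=\{uA:u\in X\}$, $X^{A^2}=\{uA^2:u\in X\}$; $X$ is $A$-invariant if $X^A=X$. $V_i=[0,i]^2\times\{i\}$. A sequence $J_0,\dots,J_k$ with $J_j$ an ideal of $[0,j]^2$ is consistent if each $J_j$ satisfies $\{x:(x,j)\in J_j\}=\{y:(j,y)\in J_j\}$ and $\bigcup_{j=0}^k[(J_j\times\{j\})\cup(J_j\times\{j\})^A\cup(J_j\times\{j\})^{A^2}]$ is an $A$-invariant ideal of $[0,k]^3$; $J_i$ is consistent with $J_0,\dots,J_{i-1}$ if $J_0,\dots,J_i$ is consistent. $J_{i,j}=\{(x,y)\in[0,i-1]^2:(x,y,j)\in I'\}$, where $I'$ is the union above for $J_0,\dots,J_{i-1}$. Boundary walk: for $R=[a,b]\times[c,d]$, a walk in $R$ is the empty sequence or a sequence $(x_0,y_0),\dots,(x_k,y_k)$ of points of $R$ with: $x_0=a$ or $y_0=d$, and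 $x_k=b$ or $y_k=c$; each step is horizontal $(x_{t-1}+h,y_{t-1})$ with $1\le h\le p$ or vertical $(x_{t-1},y_{t-1}-v)$ with $1\le v\le p^2$; steps alternate; if $a\le x_0<b$ and $y_0=d$ the first step is vertical, and if $x_k=b$, $c\le y_k<d$ the last step is horizontal; a horizontal first step has length $\le p-1$ and a vertical last step has length $\le p^2-1$. The map $W\mapsto\{(x,y)\in R:x\le x_t,\ y\le y_t\text{ for some }t\}$ is a bijection from walks onto ideals of $R$, and $\omega_R$ is its inverse. If $J_i=\emptyset$, condition (1) is vacuous. -}

module Defs where

open import Level using (0ℓ)
open import Data.Nat as ℕ using (ℕ; zero; suc)
open import Data.Integer as ℤ using (ℤ; +_; _+_; _-_; _*_; _≤_; _<_)
open import Data.Product using (Σ; ∃; _×_; _,_)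
open import Data.Sum using (_⊎_)
open import Data.Unit using (⊤)
open import Data.Empty using (⊥)
open import Data.Maybe using (Maybe; just; nothing)
open import Relation.Unary using (Pred)
open import Relation.Binary.PropositionalEquality using (_≡_)

Pt2 : Set
Pt2 = ℤ × ℤ

Pt3 : Set
Pt3 = ℤ × ℤ × ℤ

PtSet2 : Set₁
PtSet2 = Pred Pt2 0ℓ

PtSet3 : Set₁
PtSet3 = Pred Pt3 0ℓ

_-₂_ : Pt2 → Pt2 → Pt2
(x , y) -₂ (x' , y') = (x - x' , y - y')

_+₃_ : Pt3 → Pt3 → Pt3
(x , y , z) +₃ (x' , y' , z') = (x + x' , y + y' , z + z')

_-₃_ : Pt3 → Pt3 → Pt3
(x , y , z) -₃ (x' , y' , z') = (x - x' , y - y' , z - z')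

InD : ℕ → Pt2 → Set
InD p (x , y) = (x + (+ p) * y ≤ + 0) × ((+ p) * (+ p) * x + y ≤ + 0)

InΔ : ℕ → Pt3 → Set
InΔ p (x , y , z) =
  (x + P * y + P * P * z ≤ + 0) ×
  (P * P * x + y + P * z ≤ + 0) ×
  (P * x + P * P * y + z ≤ + 0)
  where P = + p

Prec2 : ℕ → Pt2 → Pt2 → Set
Prec2 p u v = Σ Pt2 λ d → InD p d × u ≡ (let (a , b) = v ; (c , e) = d in (a + c , b + e))

Prec3 : ℕ → Pt3 → Pt3 → Set
Prec3 p u v = Σ Pt3 λ d → InΔ p d × u ≡ v +₃ d

_⊆₂_ : PtSet2 → PtSet2 → Set
X ⊆₂ Y = ∀ u → X u → Y u

_⊆₃_ : PtSet3 → PtSet3 → Set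
X ⊆₃ Y = ∀ u → X u → Y u

_∩₃_ : PtSet3 → PtSet3 → PtSet3
(X ∩₃ Y) u = X u × Y u

InInterval : ℤ → ℤ → ℤ → Set
InInterval a b x = (a ≤ x) × (x ≤ b)

Rect : ℤ → ℤ → ℤ → ℤ → PtSet2
Rect a b c d (x , y) = InInterval a b x × InInterval c d y

Box2 : ℕ → PtSet2
Box2 j = Rect (+ 0) (+ j) (+ 0) (+ j)

Box3 : ℕ → PtSet3
Box3 k (x , y , z) =
  InInterval (+ 0) (+ k) x × InInterval (+ 0) (+ k) y × InInterval (+ 0) (+ k) z

_×at_ : PtSet2 → ℕ → PtSet3
(X ×at j) (x , y , z) = X (x , y) × z ≡ + j

V : ℕ → PtSet3
V i = Box2 i ×at i

rotA : Pt3 → Pt3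
rotA (x , y , z) = (y , z , x)

rotA² : Pt3 → Pt3
rotA² (x , y , z) = (z , x , y)

_^A : PtSet3 → PtSet3
(X ^A) v = Σ Pt3 λ u → X u × v ≡ rotA u

_^A² : PtSet3 → PtSet3
(X ^A²) v = Σ Pt3 λ u → X u × v ≡ rotA² u

_+Δ[_] : PtSet3 → ℕ → PtSet3
(X +Δ[ p ]) w = Σ Pt3 λ u → Σ Pt3 λ d → X u × InΔ p d × w ≡ u +₃ d

IsIdeal2 : ℕ → PtSet2 → PtSet2 → Set
IsIdeal2 p Ω I = (I ⊆₂ Ω) × (∀ u v → I u → Ω v → Prec2 p v u → I v)

IsIdeal3 : ℕ → PtSet3 → PtSet3 → Set
IsIdeal3 p Ω I = (I ⊆₃ Ω) × (∀ u v → I u → Ω v → Prec3 p v u → I v)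

AInvariant : PtSet3 → Set
AInvariant X = ((X ^A) ⊆₃ X) × (X ⊆₃ (X ^A))

-- Consistency of a sequence J_0,…,J_k  (J j is J_j; values j > k unused)

SymEdge : ℕ → PtSet2 → Set
SymEdge j Jj = (∀ x → Jj (x , + j) → Jj (+ j , x)) × (∀ y → Jj (+ j , y) → Jj (y , + j))

Union : ℕ → (ℕ → PtSet2) → PtSet3
Union k J w = Σ ℕ λ j → (j ℕ.≤ k) ×
  ((J j ×at j) w ⊎ ((J j ×at j) ^A) w ⊎ ((J j ×at j) ^A²) w)

-- J_0,…,J_k is consistent (the J_j are assumed to be ideals of [0,j]^2)
Consistent : ℕ → ℕ → (ℕ → PtSet2) → Set
Consistent p k J =
  (∀ j → j ℕ.≤ k → SymEdge j (J j)) ×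
  (IsIdeal3 p (Box3 k) (Union k J) × AInvariant (Union k J))

-- J_0,…,J_{i-1} is consistent (the empty sequence, i = 0, is trivially so)
ConsistentBelow : ℕ → ℕ → (ℕ → PtSet2) → Set
ConsistentBelow p zero    J = ⊤
ConsistentBelow p (suc k) J = Consistent p k J

-- J_{i,j} = {(x,y) ∈ [0,i-1]^2 : (x,y,j) ∈ I'},  I' the union for J_0,…,J_{i-1}
Jij : ℕ → (ℕ → PtSet2) → ℕ → PtSet2
Jij zero    J j u       = ⊥
Jij (suc k) J j (x , y) = Box2 k (x , y) × Union k J (x , y , + j)

HStep : ℕ → Pt2 → Pt2 → Set
HStep p (x , y) (x' , y') = Σ ℤ λ h → (+ 1 ≤ h) × (h ≤ + p) × x' ≡ x + h × y' ≡ y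

VStep : ℕ → Pt2 → Pt2 → Set
VStep p (x , y) (x' , y') = Σ ℤ λ v → (+ 1 ≤ v) × (v ≤ + (p ℕ.* p)) × x' ≡ x × y' ≡ y - v

-- A nonempty walk (x_0,y_0),…,(x_k,y_k): the length index k and the points
-- (only the values pt 0, …, pt k are meaningful).
record NEWalk : Set where
  constructor mkWalk
  field
    len : ℕ
    pt  : ℕ → Pt2
open NEWalk public

Walk : Set
Walk = Maybe NEWalk

xc : Pt2 → ℤ
xc (x , y) = x

yc : Pt2 → ℤ
yc (x , y) = y

IsNEWalk : ℕ → ℤ → ℤ → ℤ → ℤ → NEWalk → Set
IsNEWalk p a b c d (mkWalk k w) =
  (∀ t → t ℕ.≤ k → Rect a b c d (w t)) ×
  (xc (w 0) ≡ a ⊎ yc (w 0) ≡ d) ×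
  (xc (w k) ≡ b ⊎ yc (w k) ≡ c) ×
  (∀ t → t ℕ.< k → HStep p (w t) (w (suc t)) ⊎ VStep p (w t) (w (suc t))) ×
  (∀ t → suc t ℕ.< k →
     ¬H² (w t) (w (suc t)) (w (suc (suc t))) × ¬V² (w t) (w (suc t)) (w (suc (suc t)))) ×
  (0 ℕ.< k → a ≤ xc (w 0) → xc (w 0) < b → yc (w 0) ≡ d → VStep p (w 0) (w 1)) ×
  (∀ k' → k ≡ suc k' → xc (w k) ≡ b → c ≤ yc (w k) → yc (w k) < d →
     HStep p (w k') (w k)) ×
  (0 ℕ.< k → HStep p (w 0) (w 1) → xc (w 1) - xc (w 0) ≤ + p - + 1) ×
  (∀ k' → k ≡ suc k' → VStep p (w k') (w k) →
     yc (w k') - yc (w k) ≤ + (p ℕ.* p) - + 1)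
  where
  ¬H² : Pt2 → Pt2 → Pt2 → Set
  ¬H² u v z = HStep p u v → HStep p v z → ⊥
  ¬V² : Pt2 → Pt2 → Pt2 → Set
  ¬V² u v z = VStep p u v → VStep p v z → ⊥

IsWalk : ℕ → ℤ → ℤ → ℤ → ℤ → Walk → Set
IsWalk p a b c d nothing  = ⊤
IsWalk p a b c d (just W) = IsNEWalk p a b c d W

WalkIdeal : ℤ → ℤ → ℤ → ℤ → Walk → PtSet2
WalkIdeal a b c d nothing  u = ⊥
WalkIdeal a b c d (just (mkWalk k w)) u =
  Rect a b c d u × Σ ℕ λ t → (t ℕ.≤ k) × (xc u ≤ xc (w t)) × (yc u ≤ yc (w t))

IsOmega : ℕ → ℤ → ℤ → ℤ → ℤ → PtSet2 → Walk → Set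
IsOmega p a b c d J W =
  IsWalk p a b c d W × (WalkIdeal a b c d W ⊆₂ J) × (J ⊆₂ WalkIdeal a b c d W)

Cond1 : ℕ → Walk → Set
Cond1 i nothing = ⊤
Cond1 i (just (mkWalk k w)) = yc (w 0) ≡ + i → w 0 ≡ (yc (w k) , xc (w k))

-- The union I of the rotated layers is A-invariant by construction, so consistency amounts
-- to the symmetry of the top edge of J_i, which (4) and (5) give at the points (x,i,i) and
-- (i,y,i), and to I being an ideal of [0,i]^3. Take v ≺ u with u ∈ I and v ∈ [0,i]^3; since
-- Δ is A-invariant we may rotate, which leaves two situations. Either v lies in V_i: then
-- v ∈ J_i × {i} follows from the ideal property of J_i when u ∈ J_i × {i} (the step then has
-- zero third coordinate, so it lies in D), from (4) or (5) when u is a rotated point of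
-- level i, and from (3) when u lies in a lower layer. Or v lies in [0,i-1]^3: then (2) or
-- the ideal property of the old union applies. Conversely, (2)-(5) are instances of the ideal
-- property, and (1) follows from the symmetry of the top edge of J_i by following its
-- boundary walk from both ends.
module Submission where

open import Defs
open import Data.Nat using (ℕ; zero; suc; _≤_; _<_; _*_; _∸_; _/_; z≤n; s≤s)
import Data.Nat.Properties as ℕₚ
open import Data.Nat.Divisibility using (_∣_)
open import Data.Nat.Primality using (Prime)
open import Data.Integer as ℤ using (ℤ; +_; -[1+_]; +[1+_]; +≤+; +<+; -<+)
import Data.Integer.Properties as ℤₚ
open import Algebra.Bundles using (AbelianGroup)
open import Algebra.Properties.Group (AbelianGroup.group ℤₚ.+-0-abelianGroup)
  using (identityʳ-unique)
open import Data.Product using (Σ; _×_; _,_; proj₁; proj₂)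
open import Data.Sum as Sum using (_⊎_; inj₁; inj₂)
open import Data.Empty using (⊥-elim)
open import Data.Unit using (tt)
open import Data.Maybe using (just; nothing)
open import Relation.Binary.PropositionalEquality using (_≡_; refl; sym; trans; cong₂; subst)
open import Relation.Nullary using (¬_; yes; no)
open import Function.Bundles using (_⇔_; mk⇔)

private
  variable
    i j k : ℕ
    J : ℕ → PtSet2
    X Y Z : PtSet3
    v : Pt3

interval-ℕ : ∀ {z} → InInterval (+ 0) (+ k) z → Σ ℕ λ n → z ≡ + n × n ≤ k
interval-ℕ {z = + n} (_ , +≤+ n≤k) = n , refl , n≤k

interval-zero : ∀ {z} → InInterval (+ 0) (+ 0) z → z ≡ + 0
interval-zero (0≤z , z≤0) = ℤₚ.≤-antisym z≤0 0≤z

interval-suc : ∀ {z} → InInterval (+ 0) (+ suc k) z → z ≡ + suc k ⊎ InInterval (+ 0) (+ k) z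
interval-suc {z = + n} (0≤n , +≤+ n≤1+k) with ℕₚ.m≤n⇒m<n∨m≡n n≤1+k
... | inj₁ (s≤s n≤k) = inj₂ (0≤n , +≤+ n≤k)
... | inj₂ refl      = inj₁ refl

interval-top : InInterval (+ 0) (+ k) (+ k)
interval-top = +≤+ z≤n , ℤₚ.≤-refl

interval-mono : ∀ {z} → j ≤ k → InInterval (+ 0) (+ j) z → InInterval (+ 0) (+ k) z
interval-mono j≤k (0≤z , z≤j) = 0≤z , ℤₚ.≤-trans z≤j (+≤+ j≤k)

interval-∌suc : ¬ InInterval (+ 0) (+ k) (+ suc k)
interval-∌suc (_ , 1+k≤k) = ℕₚ.1+n≰n (ℤₚ.drop‿+≤+ 1+k≤k)

interval-∋⇒≡ : j ≤ i → InInterval (+ 0) (+ j) (+ i) → j ≡ i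
interval-∋⇒≡ j≤i (_ , i≤j) = ℕₚ.≤-antisym j≤i (ℤₚ.drop‿+≤+ i≤j)

+-rotate : ∀ a b c → a ℤ.+ b ℤ.+ c ≡ b ℤ.+ c ℤ.+ a
+-rotate a b c = trans (ℤₚ.+-assoc a b c) (ℤₚ.+-comm a (b ℤ.+ c))

InΔ-rotA : ∀ p d → InΔ p d → InΔ p (rotA d)
InΔ-rotA p (x , y , z) (c₁ , c₂ , c₃) =
  subst (ℤ._≤ + 0) (+-rotate (P ℤ.* P ℤ.* x) y (P ℤ.* z)) c₂ ,
  subst (ℤ._≤ + 0) (+-rotate (P ℤ.* x) (P ℤ.* P ℤ.* y) z) c₃ ,
  subst (ℤ._≤ + 0) (+-rotate x (P ℤ.* y) (P ℤ.* P ℤ.* z)) c₁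
  where P = + p

InΔ-rotA² : ∀ p d → InΔ p d → InΔ p (rotA² d)
InΔ-rotA² p (x , y , z) Δd = InΔ-rotA p (y , z , x) (InΔ-rotA p (x , y , z) Δd)

InΔ-zero : ∀ p → InΔ p (+ 0 , + 0 , + 0)
InΔ-zero p rewrite ℤₚ.*-zeroʳ (+ p) | ℤₚ.*-zeroʳ (+ p ℤ.* + p) =
  ℤₚ.≤-refl , ℤₚ.≤-refl , ℤₚ.≤-refl

InΔ-flat⇒InD : ∀ p {x y} → InΔ p (x , y , + 0) → InD p (x , y)
InΔ-flat⇒InD p {x} {y} (c₁ , c₂ , _) =
  subst (ℤ._≤ + 0) (drop-*0 x (+ p ℤ.* y) (+ p ℤ.* + p)) c₁ ,
  subst (ℤ._≤ + 0) (drop-*0 (+ p ℤ.* + p ℤ.* x) y (+ p)) c₂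
  where
  drop-*0 : ∀ a b c → a ℤ.+ b ℤ.+ c ℤ.* + 0 ≡ a ℤ.+ b
  drop-*0 a b c rewrite ℤₚ.*-zeroʳ c = ℤₚ.+-identityʳ (a ℤ.+ b)

Orbit : PtSet3 → PtSet3
Orbit X w = X w ⊎ (X ^A) w ⊎ (X ^A²) w

Orbit-rotA : ∀ w → Orbit X w → Orbit X (rotA w)
Orbit-rotA w (inj₁ Xw)                                 = inj₂ (inj₁ (w , Xw , refl))
Orbit-rotA _ (inj₂ (inj₁ (u@(_ , _ , _) , Xu , refl))) = inj₂ (inj₂ (u , Xu , refl))
Orbit-rotA _ (inj₂ (inj₂ ((_ , _ , _) , Xu , refl)))   = inj₁ Xu

Orbit-∌Box3 : ∀ {I} → Orbit (I ×at suc k) v → ¬ Box3 k v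
Orbit-∌Box3 (inj₁ (_ , refl)) (_ , _ , Iz) = interval-∌suc Iz
Orbit-∌Box3 (inj₂ (inj₁ (_ , (_ , refl) , refl))) (_ , Iy , _) = interval-∌suc Iy
Orbit-∌Box3 (inj₂ (inj₂ (_ , (_ , refl) , refl))) (Ix , _ , _) = interval-∌suc Ix

unrotA : (X ^A) (rotA v) → X v
unrotA {v = _ , _ , _} ((_ , _ , _) , Xu , refl) = Xu

unrotA² : (X ^A²) (rotA² v) → X v
unrotA² {v = _ , _ , _} ((_ , _ , _) , Xu , refl) = Xu

Union-rotA : ∀ w → Union k J w → Union k J (rotA w)
Union-rotA w (j , j≤k , o) = j , j≤k , Orbit-rotA w o

Union-rotA² : ∀ w → Union k J w → Union k J (rotA² w)
Union-rotA² w@(a , b , c) U = Union-rotA (b , c , a) (Union-rotA w U)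

Union-AInvariant : AInvariant (Union k J)
Union-AInvariant =
  (λ { _ (u , U , refl) → Union-rotA u U }) ,
  (λ { w@(a , b , c) U → (c , a , b) , Union-rotA² w U , refl })

Union-mono : j ≤ k → Union j J v → Union k J v
Union-mono j≤k (l , l≤j , o) = l , ℕₚ.≤-trans l≤j j≤k , o

Orbit⊆Union : Orbit (J k ×at k) ⊆₃ Union k J
Orbit⊆Union _ o = _ , ℕₚ.≤-refl , o

Union-zero : ∀ w → Union zero J w → Orbit (J zero ×at zero) w
Union-zero _ (_ , z≤n , o) = o

Union-suc : ∀ w → Union (suc k) J w → Orbit (J (suc k) ×at suc k) w ⊎ Union k J w
Union-suc _ (j , j≤1+k , o) with ℕₚ.m≤n⇒m<n∨m≡n j≤1+k
... | inj₁ (s≤s j≤k) = inj₂ (j , j≤k , o)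
... | inj₂ refl      = inj₁ o

Union-suc-∩Box3 : Union (suc k) J v → Box3 k v → Union k J v
Union-suc-∩Box3 {v = v} U Bv with Union-suc v U
... | inj₁ o  = ⊥-elim (Orbit-∌Box3 o Bv)
... | inj₂ U′ = U′

Box3-rotA : Box3 k v → Box3 k (rotA v)
Box3-rotA {v = _ , _ , _} (Ix , Iy , Iz) = Iy , Iz , Ix

Box3-rotA² : Box3 k v → Box3 k (rotA² v)
Box3-rotA² {v = _ , _ , _} (Ix , Iy , Iz) = Iz , Ix , Iy

V⊆Box3 : V k ⊆₃ Box3 k
V⊆Box3 _ ((Ix , Iy) , refl) = Ix , Iy , interval-top

V^A⊆Box3 : (V k ^A) ⊆₃ Box3 k
V^A⊆Box3 _ (u , Vu , refl) = Box3-rotA (V⊆Box3 u Vu)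

V^A²⊆Box3 : (V k ^A²) ⊆₃ Box3 k
V^A²⊆Box3 _ (u , Vu , refl) = Box3-rotA² (V⊆Box3 u Vu)

Box3-zero : Box3 zero v → V zero v
Box3-zero {v = _ , _ , _} (Ix , Iy , Iz) = (Ix , Iy) , interval-zero Iz

Box3-suc : Box3 (suc k) v → (V (suc k) v ⊎ V (suc k) (rotA v) ⊎ V (suc k) (rotA² v)) ⊎ Box3 k v
Box3-suc {v = _ , _ , _} (Ix , Iy , Iz) with interval-suc Iz | interval-suc Iy | interval-suc Ix
... | inj₁ z≡ | _       | _       = inj₁ (inj₁ ((Ix , Iy) , z≡))
... | inj₂ _  | inj₂ _  | inj₁ x≡ = inj₁ (inj₂ (inj₁ ((Iy , Iz) , x≡)))
... | inj₂ _  | inj₁ y≡ | _       = inj₁ (inj₂ (inj₂ ((Iz , Ix) , y≡)))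
... | inj₂ Iz′ | inj₂ Iy′ | inj₂ Ix′ = inj₂ (Ix′ , Iy′ , Iz′)

Ideals : ℕ → ℕ → (ℕ → PtSet2) → Set
Ideals p i J = ∀ j → j ≤ i → IsIdeal2 p (Box2 j) (J j)

Cond2 : ℕ → ℕ → (ℕ → PtSet2) → Set
Cond2 p i J =
  ∀ j → j < i → (((J i ×at i) +Δ[ p ]) ∩₃ (Box2 (i ∸ 1) ×at j)) ⊆₃ (Jij i J j ×at j)

Cond3 : ℕ → ℕ → (ℕ → PtSet2) → Set
Cond3 p i J = ∀ j → j < i → (((Jij i J j ×at j) +Δ[ p ]) ∩₃ V i) ⊆₃ (J i ×at i)

Cond4 : ℕ → ℕ → (ℕ → PtSet2) → Set
Cond4 p i J = (((J i ×at i) +Δ[ p ]) ∩₃ (V i ^A)) ⊆₃ ((J i ×at i) ^A)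

Cond5 : ℕ → ℕ → (ℕ → PtSet2) → Set
Cond5 p i J = (((J i ×at i) +Δ[ p ]) ∩₃ (V i ^A²)) ⊆₃ ((J i ×at i) ^A²)

module _ {p : ℕ} where

  +Δ-inflationary : X ⊆₃ (X +Δ[ p ])
  +Δ-inflationary (x , y , z) Xu =
    (x , y , z) , (+ 0 , + 0 , + 0) , Xu , InΔ-zero p ,
    sym (cong₂ _,_ (ℤₚ.+-identityʳ x) (cong₂ _,_ (ℤₚ.+-identityʳ y) (ℤₚ.+-identityʳ z)))

  +Δ-map : X ⊆₃ Y → (X +Δ[ p ]) ⊆₃ (Y +Δ[ p ])
  +Δ-map X⊆Y _ (u , d , Xu , Δd , eq) = u , d , X⊆Y u Xu , Δd , eq

  +Δ-split : (∀ w → X w → Y w ⊎ Z w) → (X +Δ[ p ]) v → (Y +Δ[ p ]) v ⊎ (Z +Δ[ p ]) v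
  +Δ-split split (u , d , Xu , Δd , eq) =
    Sum.map (λ Yu → u , d , Yu , Δd , eq) (λ Zu → u , d , Zu , Δd , eq) (split u Xu)

  +Δ-rotA : (∀ w → X w → X (rotA w)) → (X +Δ[ p ]) v → (X +Δ[ p ]) (rotA v)
  +Δ-rotA rot (u@(_ , _ , _) , d@(_ , _ , _) , Xu , Δd , refl) =
    rotA u , rotA d , rot u Xu , InΔ-rotA p d Δd , refl

  +Δ-^A : ((X ^A) +Δ[ p ]) v → (X +Δ[ p ]) (rotA² v)
  +Δ-^A (_ , d@(_ , _ , _) , (u@(_ , _ , _) , Xu , refl) , Δd , refl) =
    u , rotA² d , Xu , InΔ-rotA² p d Δd , refl

  +Δ-^A² : ((X ^A²) +Δ[ p ]) v → (X +Δ[ p ]) (rotA v)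
  +Δ-^A² (_ , d@(_ , _ , _) , (u@(_ , _ , _) , Xu , refl) , Δd , refl) =
    u , rotA d , Xu , InΔ-rotA p d Δd , refl

  -- Two points of the layer z = j differ by a vector of Δ with zero last coordinate,
  -- and such vectors lie in D.
  ×at-+Δ-closed : ∀ {Ω I} → IsIdeal2 p Ω I →
                  (((I ×at j) +Δ[ p ]) ∩₃ (Ω ×at j)) ⊆₃ (I ×at j)
  ×at-+Δ-closed {j = j} (_ , closed) _
    (((x , y , _) , (d₁ , d₂ , d₃) , (Ixy , refl) , Δd , refl) , (Ωv , j+d₃≡j)) =
    closed (x , y) _ Ixy Ωv ((d₁ , d₂) , InΔ-flat⇒InD p flat , refl) , j+d₃≡j
    where
    flat : InΔ p (d₁ , d₂ , + 0)
    flat = subst (λ t → InΔ p (d₁ , d₂ , t)) (identityʳ-unique (+ j) d₃ j+d₃≡j) Δd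

  ideal-+Δ : ∀ {Ω I} → IsIdeal3 p Ω I → X ⊆₃ I → ((X +Δ[ p ]) ∩₃ Ω) ⊆₃ I
  ideal-+Δ (_ , closed) X⊆I v ((u , d , Xu , Δd , eq) , Ωv) =
    closed u v (X⊆I u Xu) Ωv (d , Δd , eq)

  +Δ-closed⇒IsIdeal3 : ∀ {Ω I} → I ⊆₃ Ω → ((I +Δ[ p ]) ∩₃ Ω) ⊆₃ I → IsIdeal3 p Ω I
  +Δ-closed⇒IsIdeal3 I⊆Ω closed =
    I⊆Ω , λ u v Iu Ωv (d , Δd , eq) → closed v ((u , d , Iu , Δd , eq) , Ωv)

  Orbit-+Δ : ((Orbit X) +Δ[ p ]) v →
             (X +Δ[ p ]) v ⊎ (X +Δ[ p ]) (rotA² v) ⊎ (X +Δ[ p ]) (rotA v)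
  Orbit-+Δ (u , d , inj₁ Xu , Δd , eq)        = inj₁ (u , d , Xu , Δd , eq)
  Orbit-+Δ (u , d , inj₂ (inj₁ Xu) , Δd , eq) = inj₂ (inj₁ (+Δ-^A (u , d , Xu , Δd , eq)))
  Orbit-+Δ (u , d , inj₂ (inj₂ Xu) , Δd , eq) = inj₂ (inj₂ (+Δ-^A² (u , d , Xu , Δd , eq)))

  module _ {J : ℕ → PtSet2} where

    Union⊆Box3 : Ideals p k J → Union k J ⊆₃ Box3 k
    Union⊆Box3 idl (x , y , _) (j , j≤k , inj₁ (Jxy , refl)) =
      let (Ix , Iy) = proj₁ (idl j j≤k) _ Jxy
      in interval-mono j≤k Ix , interval-mono j≤k Iy , interval-mono j≤k interval-top
    Union⊆Box3 idl _ (j , j≤k , inj₂ (inj₁ (u , (Ju , refl) , refl))) =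
      let (Ix , Iy) = proj₁ (idl j j≤k) _ Ju
      in interval-mono j≤k Iy , interval-mono j≤k interval-top , interval-mono j≤k Ix
    Union⊆Box3 idl _ (j , j≤k , inj₂ (inj₂ (u , (Ju , refl) , refl))) =
      let (Ix , Iy) = proj₁ (idl j j≤k) _ Ju
      in interval-mono j≤k interval-top , interval-mono j≤k Ix , interval-mono j≤k Iy

    Union-top : Ideals p i J → SymEdge i (J i) → ∀ {a b} → Union i J (a , b , + i) → J i (a , b)
    Union-top _ _ (_ , _ , inj₁ (Jab , refl)) = Jab
    Union-top {i = i} idl (_ , sym-y) (j , j≤i , inj₂ (inj₁ (_ , (Jx , refl) , refl)))
      with interval-∋⇒≡ j≤i (proj₁ (proj₁ (idl j j≤i) _ Jx))
    ... | refl = sym-y _ Jx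
    Union-top {i = i} idl (sym-x , _) (j , j≤i , inj₂ (inj₂ (_ , (Jy , refl) , refl)))
      with interval-∋⇒≡ j≤i (proj₂ (proj₁ (idl j j≤i) _ Jy))
    ... | refl = sym-x _ Jy

    consistent⇒Cond2 : Consistent p i J → Cond2 p i J
    consistent⇒Cond2 {i = suc k} (_ , ideal , _) j (s≤s j≤k) (a , b , _) (v∈ , ((Ia , Ib) , refl)) =
      ((Ia , Ib) , Union-suc-∩Box3 Uv (Ia , Ib , interval-mono j≤k interval-top)) , refl
      where
      Uv : Union (suc k) J (a , b , + j)
      Uv = ideal-+Δ ideal (λ w x → Orbit⊆Union w (inj₁ x)) _
             (v∈ , interval-mono (ℕₚ.n≤1+n k) Ia , interval-mono (ℕₚ.n≤1+n k) Ib ,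
                   interval-mono (ℕₚ.m≤n⇒m≤1+n j≤k) interval-top)

    consistent⇒Cond3 : Ideals p i J → Consistent p i J → Cond3 p i J
    consistent⇒Cond3 {i = suc k} idl (symEdge , ideal , _) _ _ (_ , _ , _) (v∈ , Vv@(_ , refl)) =
      Union-top idl (symEdge _ ℕₚ.≤-refl) (ideal-+Δ ideal Jij⊆Union _ (v∈ , V⊆Box3 _ Vv)) , refl
      where
      Jij⊆Union : ∀ {j} → (Jij (suc k) J j ×at j) ⊆₃ Union (suc k) J
      Jij⊆Union (_ , _ , _) ((_ , U) , refl) = Union-mono (ℕₚ.n≤1+n k) U

    consistent⇒Cond4 : Ideals p i J → Consistent p i J → Cond4 p i J
    consistent⇒Cond4 idl (symEdge , ideal , _) _ (v∈ , V^A@(u@(_ , _ , _) , (_ , refl) , refl)) =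
      u , (Union-top idl (symEdge _ ℕₚ.≤-refl) (Union-rotA² _ Uv) , refl) , refl
      where
      Uv = ideal-+Δ ideal (λ w x → Orbit⊆Union w (inj₁ x)) _ (v∈ , V^A⊆Box3 _ V^A)

    consistent⇒Cond5 : Ideals p i J → Consistent p i J → Cond5 p i J
    consistent⇒Cond5 idl (symEdge , ideal , _) _ (v∈ , V^A²@(u@(_ , _ , _) , (_ , refl) , refl)) =
      u , (Union-top idl (symEdge _ ℕₚ.≤-refl) (Union-rotA _ Uv) , refl) , refl
      where
      Uv = ideal-+Δ ideal (λ w x → Orbit⊆Union w (inj₁ x)) _ (v∈ , V^A²⊆Box3 _ V^A²)

    Cond4∧Cond5⇒SymEdge : IsIdeal2 p (Box2 i) (J i) → Cond4 p i J → Cond5 p i J → SymEdge i (J i)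
    Cond4∧Cond5⇒SymEdge {i = i} (J⊆Box , _) c4 c5 =
      (λ x Jx → proj₁ (unrotA (c4 _ (+Δ-inflationary _ (Jx , refl) ,
                                     (_ , ((interval-top , proj₁ (J⊆Box _ Jx)) , refl) , refl))))) ,
      (λ y Jy → proj₁ (unrotA² (c5 _ (+Δ-inflationary _ (Jy , refl) ,
                                      (_ , ((proj₂ (J⊆Box _ Jy) , interval-top) , refl) , refl)))))

    layer-top : IsIdeal2 p (Box2 i) (J i) → Cond4 p i J → Cond5 p i J →
                ((Orbit (J i ×at i) +Δ[ p ]) ∩₃ V i) ⊆₃ (J i ×at i)
    layer-top idl c4 c5 v (v∈ , Vv) with Orbit-+Δ v∈
    ... | inj₁ v∈′           = ×at-+Δ-closed idl v (v∈′ , Vv)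
    ... | inj₂ (inj₁ rotA²v∈) = unrotA² (c5 _ (rotA²v∈ , (v , Vv , refl)))
    ... | inj₂ (inj₂ rotAv∈)  = unrotA (c4 _ (rotAv∈ , (v , Vv , refl)))

    lower-top : Consistent p k J → Cond3 p (suc k) J →
                ((Union k J +Δ[ p ]) ∩₃ V (suc k)) ⊆₃ (J (suc k) ×at suc k)
    lower-top (_ , (U⊆Box , _) , _) c3 v ((u@(_ , _ , _) , d , Uu , Δd , eq) , Vv)
      with U⊆Box u Uu
    ... | Ix , Iy , Iz with interval-ℕ Iz
    ... | n , refl , n≤k = c3 n (s≤s n≤k) v ((u , d , (((Ix , Iy) , Uu) , refl) , Δd , eq) , Vv)

    top-closed : Ideals p i J → ConsistentBelow p i J → Cond3 p i J → Cond4 p i J → Cond5 p i J →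
                 ((Union i J +Δ[ p ]) ∩₃ V i) ⊆₃ (J i ×at i)
    top-closed {i = zero} idl _ _ c4 c5 v (v∈ , Vv) =
      layer-top (idl 0 z≤n) c4 c5 v (+Δ-map Union-zero v v∈ , Vv)
    top-closed {i = suc k} idl cb c3 c4 c5 v (v∈ , Vv) with +Δ-split Union-suc v∈
    ... | inj₁ layer∈ = layer-top (idl _ ℕₚ.≤-refl) c4 c5 v (layer∈ , Vv)
    ... | inj₂ lower∈ = lower-top cb c3 v (lower∈ , Vv)

    layer-below : Cond2 p (suc k) J →
                  (((J (suc k) ×at suc k) +Δ[ p ]) ∩₃ Box3 k) ⊆₃ Union k J
    layer-below c2 (_ , _ , _) (v∈ , (Ia , Ib , Ic)) with interval-ℕ Ic
    ... | n , refl , n≤k = proj₂ (proj₁ (c2 n (s≤s n≤k) _ (v∈ , ((Ia , Ib) , refl))))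

    below-closed : Consistent p k J → Cond2 p (suc k) J →
                   ((Union (suc k) J +Δ[ p ]) ∩₃ Box3 k) ⊆₃ Union k J
    below-closed (_ , lowerIdeal , _) c2 v@(_ , _ , _) (v∈ , Bv) with +Δ-split Union-suc v∈
    ... | inj₂ lower∈ = ideal-+Δ lowerIdeal (λ _ U → U) v (lower∈ , Bv)
    ... | inj₁ layer∈ with Orbit-+Δ layer∈
    ...   | inj₁ v∈′           = layer-below c2 v (v∈′ , Bv)
    ...   | inj₂ (inj₁ rotA²v∈) = Union-rotA _ (layer-below c2 _ (rotA²v∈ , Box3-rotA² Bv))
    ...   | inj₂ (inj₂ rotAv∈)  = Union-rotA² _ (layer-below c2 _ (rotAv∈ , Box3-rotA Bv))

    Union-+Δ-closed : Ideals p i J → ConsistentBelow p i J →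
                      Cond2 p i J → Cond3 p i J → Cond4 p i J → Cond5 p i J →
                      ((Union i J +Δ[ p ]) ∩₃ Box3 i) ⊆₃ Union i J
    Union-+Δ-closed {i = zero} idl cb _ c3 c4 c5 v (v∈ , Bv) =
      Orbit⊆Union v (inj₁ (top-closed idl cb c3 c4 c5 v (v∈ , Box3-zero Bv)))
    Union-+Δ-closed {i = suc k} idl cb c2 c3 c4 c5 v@(_ , _ , _) (v∈ , Bv) = by-cases (Box3-suc Bv)
      where
      top : ∀ {w} → V (suc k) w → (Union (suc k) J +Δ[ p ]) w → Union (suc k) J w
      top Vw w∈ = Orbit⊆Union _ (inj₁ (top-closed idl cb c3 c4 c5 _ (w∈ , Vw)))

      by-cases : (V (suc k) v ⊎ V (suc k) (rotA v) ⊎ V (suc k) (rotA² v)) ⊎ Box3 k v → Union (suc k) J v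
      by-cases (inj₁ (inj₁ Vv))        = top Vv v∈
      by-cases (inj₁ (inj₂ (inj₁ Vv))) = Union-rotA² _ (top Vv (+Δ-rotA Union-rotA v∈))
      by-cases (inj₁ (inj₂ (inj₂ Vv))) = Union-rotA _ (top Vv (+Δ-rotA Union-rotA (+Δ-rotA Union-rotA v∈)))
      by-cases (inj₂ Bv′)              = Union-mono (ℕₚ.n≤1+n k) (below-closed cb c2 v (v∈ , Bv′))

    symEdges : Ideals p i J → ConsistentBelow p i J → SymEdge i (J i) →
               ∀ j → j ≤ i → SymEdge j (J j)
    symEdges _ _ symEdgeᵢ j j≤i with ℕₚ.m≤n⇒m<n∨m≡n j≤i
    symEdges _ _ symEdgeᵢ j j≤i | inj₂ refl = symEdgeᵢ
    symEdges {i = suc k} _ (symEdge , _) _ j _ | inj₁ (s≤s j≤k) = symEdge j j≤k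

    conditions⇒consistent : Ideals p i J → ConsistentBelow p i J →
                            Cond2 p i J → Cond3 p i J → Cond4 p i J → Cond5 p i J →
                            Consistent p i J
    conditions⇒consistent {i = i} idl cb c2 c3 c4 c5 =
      symEdges idl cb (Cond4∧Cond5⇒SymEdge (idl i ℕₚ.≤-refl) c4 c5) ,
      +Δ-closed⇒IsIdeal3 (Union⊆Box3 idl) (Union-+Δ-closed idl cb c2 c3 c4 c5) ,
      Union-AInvariant

Step : ℕ → Pt2 → Pt2 → Set
Step p u v = HStep p u v ⊎ VStep p u v

i<i+1+n : ∀ x n → x ℤ.< x ℤ.+ +[1+ n ]
i<i+1+n x n = subst (ℤ._< x ℤ.+ +[1+ n ]) (ℤₚ.+-identityʳ x) (ℤₚ.+-monoʳ-< x (+<+ (s≤s z≤n)))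

i-1+n<i : ∀ y n → y ℤ.- +[1+ n ] ℤ.< y
i-1+n<i y n = subst (y ℤ.+ -[1+ n ] ℤ.<_) (ℤₚ.+-identityʳ y) (ℤₚ.+-monoʳ-< y -<+)

HStep⇒x< : ∀ {p u v} → HStep p u v → xc u ℤ.< xc v
HStep⇒x< {u = x , _} (+[1+ n ] , +≤+ (s≤s _) , _ , refl , _) = i<i+1+n x n

VStep⇒y> : ∀ {p u v} → VStep p u v → yc v ℤ.< yc u
VStep⇒y> {u = _ , y} (+[1+ n ] , +≤+ (s≤s _) , _ , _ , refl) = i-1+n<i y n

Step-mono : ∀ {p u v} → Step p u v → xc u ℤ.≤ xc v × yc v ℤ.≤ yc u
Step-mono {p} (inj₁ h@(_ , _ , _ , _ , refl)) = ℤₚ.<⇒≤ (HStep⇒x< {p} h) , ℤₚ.≤-refl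
Step-mono {p} (inj₂ s@(_ , _ , _ , refl , _)) = ℤₚ.≤-refl , ℤₚ.<⇒≤ (VStep⇒y> {p} s)

steps-mono : ∀ {p} {w : ℕ → Pt2} → (∀ t → t < k → Step p (w t) (w (suc t))) →
             ∀ {t t′} → t ≤ t′ → t′ ≤ k → xc (w t) ℤ.≤ xc (w t′) × yc (w t′) ℤ.≤ yc (w t)
steps-mono steps {t′ = zero} z≤n _ = ℤₚ.≤-refl , ℤₚ.≤-refl
steps-mono steps {t} {suc t′} t≤1+t′ 1+t′≤k with ℕₚ.m≤n⇒m<n∨m≡n t≤1+t′
... | inj₂ refl = ℤₚ.≤-refl , ℤₚ.≤-refl
... | inj₁ (s≤s t≤t′) =
  let (x≤ , ≤y) = steps-mono steps t≤t′ (ℕₚ.<⇒≤ 1+t′≤k)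
      (x≤′ , ≤y′) = Step-mono (steps t′ 1+t′≤k)
  in ℤₚ.≤-trans x≤ x≤′ , ℤₚ.≤-trans ≤y′ ≤y

<⇒≡suc : ∀ {t n} → t < n → Σ ℕ λ n′ → n ≡ suc n′ × t ≤ n′
<⇒≡suc (s≤s t≤n′) = _ , refl , t≤n′

module _ {p k : ℕ} {a b c d : ℤ} {w : ℕ → Pt2} (isWalk : IsNEWalk p a b c d (mkWalk k w)) where

  private
    inR : ∀ t → t ≤ k → Rect a b c d (w t)
    inR = proj₁ isWalk

    steps : ∀ t → t < k → Step p (w t) (w (suc t))
    steps = proj₁ (proj₂ (proj₂ (proj₂ isWalk)))

    firstVertical : 0 < k → a ℤ.≤ xc (w 0) → xc (w 0) ℤ.< b → yc (w 0) ≡ d → VStep p (w 0) (w 1)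
    firstVertical = proj₁ (proj₂ (proj₂ (proj₂ (proj₂ (proj₂ isWalk)))))

    lastHorizontal : ∀ k′ → k ≡ suc k′ → xc (w k) ≡ b → c ℤ.≤ yc (w k) → yc (w k) ℤ.< d →
                     HStep p (w k′) (w k)
    lastHorizontal = proj₁ (proj₂ (proj₂ (proj₂ (proj₂ (proj₂ (proj₂ isWalk))))))

  walk-mono : ∀ {t t′} → t ≤ t′ → t′ ≤ k → xc (w t) ℤ.≤ xc (w t′) × yc (w t′) ℤ.≤ yc (w t)
  walk-mono = steps-mono steps

  -- A walk starting on the top edge away from the corner first goes down, so it never
  -- returns to the top edge.
  top-edge⇒x≡x₀ : yc (w 0) ≡ d → ∀ {t} → t ≤ k → yc (w t) ≡ d → xc (w t) ≡ xc (w 0)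
  top-edge⇒x≡x₀ _ {zero} _ _ = refl
  top-edge⇒x≡x₀ y₀≡d {suc t} t≤k yₜ≡d with xc (w 0) ℤ.<? b
  ... | no x₀≮b =
    ℤₚ.≤-antisym (ℤₚ.≤-trans (proj₂ (proj₁ (inR _ t≤k))) (ℤₚ.≮⇒≥ x₀≮b))
                 (proj₁ (walk-mono z≤n t≤k))
  ... | yes x₀<b = ⊥-elim (ℤₚ.<-irrefl refl d<d)
    where
    d<d : d ℤ.< d
    d<d = ℤₚ.≤-<-trans (subst (ℤ._≤ yc (w 1)) yₜ≡d (proj₂ (walk-mono (s≤s z≤n) t≤k)))
            (subst (yc (w 1) ℤ.<_) y₀≡d
              (VStep⇒y> {p} (firstVertical (ℕₚ.<-≤-trans (s≤s z≤n) t≤k)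
                           (proj₁ (proj₁ (inR 0 z≤n))) x₀<b y₀≡d)))

  right-edge⇒y≡yₖ : xc (w k) ≡ b → ∀ {t} → t ≤ k → xc (w t) ≡ b → yc (w t) ≡ yc (w k)
  right-edge⇒y≡yₖ xₖ≡b {t} t≤k xₜ≡b with ℕₚ.m≤n⇒m<n∨m≡n t≤k
  ... | inj₂ refl = refl
  ... | inj₁ t<k with yc (w k) ℤ.<? d
  ...   | no yₖ≮d =
    ℤₚ.≤-antisym (ℤₚ.≤-trans (proj₂ (proj₂ (inR t t≤k))) (ℤₚ.≮⇒≥ yₖ≮d))
                 (proj₂ (walk-mono t≤k ℕₚ.≤-refl))
  ...   | yes yₖ<d = let (k′ , k≡1+k′ , t≤k′) = <⇒≡suc t<k in ⊥-elim (ℤₚ.<-irrefl refl (b<b k≡1+k′ t≤k′))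
    where
    b<b : ∀ {k′} → k ≡ suc k′ → t ≤ k′ → b ℤ.< b
    b<b {k′} k≡1+k′ t≤k′ =
      ℤₚ.≤-<-trans (subst (ℤ._≤ xc (w k′)) xₜ≡b
                     (proj₁ (walk-mono t≤k′ (subst (k′ ≤_) (sym k≡1+k′) (ℕₚ.n≤1+n k′)))))
        (subst (xc (w k′) ℤ.<_) xₖ≡b
          (HStep⇒x< {p} (lastHorizontal k′ k≡1+k′ xₖ≡b (proj₁ (proj₂ (inR k ℕₚ.≤-refl))) yₖ<d)))

Cond1-of-SymEdge : ∀ {p Jᵢ} → SymEdge i Jᵢ → (W : Walk) →
                   IsOmega p (+ 0) (+ i) (+ 0) (+ i) Jᵢ W → Cond1 i W
Cond1-of-SymEdge _ nothing _ = tt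
Cond1-of-SymEdge {i} {p} {Jᵢ} (sym-x , sym-y) (just (mkWalk k w)) (isWalk , ⊆J , J⊆) y₀≡i =
  cong₂ _,_ x₀≡yₖ (trans y₀≡i (sym xₖ≡i))
  where
  inR : ∀ t → t ≤ k → Box2 i (w t)
  inR = proj₁ isWalk

  on-walk : ∀ t → t ≤ k → Jᵢ (w t)
  on-walk t t≤k = ⊆J (w t) (inR t t≤k , t , t≤k , ℤₚ.≤-refl , ℤₚ.≤-refl)

  ≥i⇒≡i : ∀ {x} → InInterval (+ 0) (+ i) x → + i ℤ.≤ x → x ≡ + i
  ≥i⇒≡i (_ , x≤i) i≤x = ℤₚ.≤-antisym x≤i i≤x

  right : WalkIdeal (+ 0) (+ i) (+ 0) (+ i) (just (mkWalk k w)) (+ i , xc (w 0))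
  right = J⊆ _ (sym-x _ (subst (λ y → Jᵢ (xc (w 0) , y)) y₀≡i (on-walk 0 z≤n)))

  xₖ≡i : xc (w k) ≡ + i
  xₖ≡i with right
  ... | _ , t , t≤k , i≤xₜ , _ =
    ≥i⇒≡i (proj₁ (inR k ℕₚ.≤-refl)) (ℤₚ.≤-trans i≤xₜ (proj₁ (walk-mono isWalk t≤k ℕₚ.≤-refl)))

  x₀≡yₖ : xc (w 0) ≡ yc (w k)
  x₀≡yₖ with right | J⊆ _ (sym-y _ (subst (λ x → Jᵢ (x , yc (w k))) xₖ≡i (on-walk k ℕₚ.≤-refl)))
  ... | _ , t , t≤k , i≤xₜ , x₀≤yₜ | _ , t′ , t′≤k , yₖ≤xₜ′ , i≤yₜ′ =
    ℤₚ.≤-antisym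
      (subst (xc (w 0) ℤ.≤_) (right-edge⇒y≡yₖ isWalk xₖ≡i t≤k (≥i⇒≡i (proj₁ (inR t t≤k)) i≤xₜ)) x₀≤yₜ)
      (subst (yc (w k) ℤ.≤_) (top-edge⇒x≡x₀ isWalk y₀≡i t′≤k (≥i⇒≡i (proj₂ (inR t′ t′≤k)) i≤yₜ′)) yₖ≤xₜ′)

lemma5p1 : (p m i : ℕ) → Prime p → 1 ≤ m → 3 ∣ m → i ≤ (m / 3) * (p ∸ 1) →
           (J : ℕ → PtSet2) →
           (∀ j → j ≤ i → IsIdeal2 p (Box2 j) (J j)) →
           ConsistentBelow p i J →
           (W : Walk) → IsOmega p (+ 0) (+ i) (+ 0) (+ i) (J i) W →
           (Consistent p i J ⇔
             (Cond1 i W ×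
              (∀ j → j < i → (((J i ×at i) +Δ[ p ]) ∩₃ (Box2 (i ∸ 1) ×at j)) ⊆₃ (Jij i J j ×at j)) ×
              (∀ j → j < i → (((Jij i J j ×at j) +Δ[ p ]) ∩₃ V i) ⊆₃ (J i ×at i)) ×
              ((((J i ×at i) +Δ[ p ]) ∩₃ (V i ^A)) ⊆₃ ((J i ×at i) ^A)) ×
              ((((J i ×at i) +Δ[ p ]) ∩₃ (V i ^A²)) ⊆₃ ((J i ×at i) ^A²))))
lemma5p1 p m i _ _ _ _ J ideals below W ω = mk⇔ to from
  where
  Conditions : Set
  Conditions = Cond1 i W × Cond2 p i J × Cond3 p i J × Cond4 p i J × Cond5 p i J

  to : Consistent p i J → Conditions
  to con@(symEdge , _) =
    Cond1-of-SymEdge (symEdge i ℕₚ.≤-refl) W ω ,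
    consistent⇒Cond2 {p} con ,
    consistent⇒Cond3 {p} ideals con ,
    consistent⇒Cond4 {p} ideals con ,
    consistent⇒Cond5 {p} ideals con

  from : Conditions → Consistent p i J
  from (_ , c2 , c3 , c4 , c5) = conditions⇒consistent {p} ideals below c2 c3 c4 c5
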